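{- Let $D$ be a derivation of $R$. For any power series $f$ in one variable and any $B\in R$, we have the following identity: $$D(f(\mathrm{ad}_{\mathfrak t})B) = \frac{f(X+Y) - f(Y)}{X} [\![ D(\mathfrak t), B ]\!]_{\mathfrak t} + f(\mathrm{ad}_{\mathfrak t})D(B).$$
   Context: $R=\mathbb{C}\langle\langle \mathfrak t, A\rangle\rangle$ is the algebra of formal non-commutative power series in $\mathfrak t$ and $A$, $\mathrm{ad}_{\mathfrak t}=(x\mapsto[\mathfrak t,x])$. For $B, C \in R$ and a formal commutative power series $g(X, Y) = \sum_{i,j\ge0} g_{ij} X^i Y^j$, one sets $$g(X, Y) [\![ B, C ]\!]_{\mathfrak t} := \sum_{i, j \geq 0} g_{ij} [\mathrm{ad}_{\mathfrak t}^i B, \mathrm{ad}_{\mathfrak t}^j C].$$ -}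

module Defs where

open import Level using (_⊔_)
open import Data.Nat using (ℕ; zero; suc; _∸_)
open import Data.List using (List; []; _∷_; map; foldr; length)
open import Data.Product using (_×_; _,_)
open import Algebra.Bundles using (CommutativeRing)

data Letter : Set where
  𝔱 : Letter
  𝔸 : Letter

Word : Set
Word = List Letter

splits : Word → List (Word × Word)
splits [] = ([] , []) ∷ []
splits (x ∷ w) = ([] , x ∷ w) ∷ map (λ { (u , v) → (x ∷ u , v) }) (splits w)

-- Formal non-commutative power series K⟨⟨𝔱, A⟩⟩ over a commutative ring K
-- (the paper takes K = ℂ, which is not available).
module NCPS {c ℓ} (K : CommutativeRing c ℓ) where
  open CommutativeRing K

  Ser : Set c
  Ser = Word → Carrier

  infix 4 _≈R_
  _≈R_ : Ser → Ser → Set ℓ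
  F ≈R G = ∀ w → F w ≈ G w

  sumL : List Carrier → Carrier
  sumL = foldr _+_ 0#

  sumUpTo : ℕ → (ℕ → Carrier) → Carrier
  sumUpTo zero F = F 0
  sumUpTo (suc n) F = sumUpTo n F + F (suc n)

  fromℕ : ℕ → Carrier
  fromℕ zero = 0#
  fromℕ (suc n) = 1# + fromℕ n

  binom : ℕ → ℕ → ℕ
  binom n zero = 1
  binom zero (suc k) = 0
  binom (suc n) (suc k) = binom n k Data.Nat.+ binom n (suc k)

  infixl 6 _+R_ _-R_
  infixl 7 _*R_ _·R_

  0R : Ser
  0R w = 0#

  1R : Ser
  1R [] = 1#
  1R (_ ∷ _) = 0#

  _+R_ : Ser → Ser → Ser
  (F +R G) w = F w + G w

  -R_ : Ser → Ser
  (-R F) w = - F w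

  _-R_ : Ser → Ser → Ser
  F -R G = F +R (-R G)

  _·R_ : Carrier → Ser → Ser
  (a ·R F) w = a * F w

  _*R_ : Ser → Ser → Ser
  (F *R G) w = sumL (map (λ { (u , v) → F u * G v }) (splits w))

  𝔱R : Ser
  𝔱R (𝔱 ∷ []) = 1#
  𝔱R _ = 0#

  AR : Ser
  AR (𝔸 ∷ []) = 1#
  AR _ = 0#

  [_,_]R : Ser → Ser → Ser
  [ F , G ]R = F *R G -R G *R F

  ad𝔱 : Ser → Ser
  ad𝔱 F = [ 𝔱R , F ]R

  ad𝔱^ : ℕ → Ser → Ser
  ad𝔱^ zero F = F
  ad𝔱^ (suc n) F = ad𝔱 (ad𝔱^ n F)

  -- Formal commutative power series in one variable / two variables,
  -- given by their coefficients.
  PS1 : Set c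
  PS1 = ℕ → Carrier

  PS2 : Set c
  PS2 = ℕ → ℕ → Carrier

  -- f(ad_𝔱) B = Σ_i f_i ad_𝔱^i B.  Since ad_𝔱^i B only has monomials of
  -- degree ≥ i, the coefficient of w in this (formally convergent) sum is the
  -- finite sum over i ≤ length w.
  evalAd : PS1 → Ser → Ser
  evalAd f B w = sumUpTo (length w) (λ i → f i * ad𝔱^ i B w)

  -- g(X,Y)[[B,C]]_𝔱 = Σ_{i,j} g_ij [ad^i B, ad^j C].  The (i,j) term only has
  -- monomials of degree ≥ i + j, so the coefficient of w is the finite sum
  -- over i + j ≤ length w.
  bracket𝔱 : PS2 → Ser → Ser → Ser
  bracket𝔱 g B C w =
    sumUpTo (length w) (λ i → sumUpTo (length w ∸ i) (λ j →
      g i j * [ ad𝔱^ i B , ad𝔱^ j C ]R w))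

  -- f(X + Y): coefficient of X^i Y^j is binom(i+j, i) f_{i+j}
  substXplusY : PS1 → PS2
  substXplusY f i j = fromℕ (binom (i Data.Nat.+ j) i) * f (i Data.Nat.+ j)

  -- f(Y): coefficient of X^0 Y^j is f_j, others 0
  substY : PS1 → PS2
  substY f zero j = f j
  substY f (suc i) j = 0#

  _-PS2_ : PS2 → PS2 → PS2
  (g -PS2 h) i j = g i j - h i j

  -- division by X of a two-variable series (meaningful when it is divisible
  -- by X, i.e. all coefficients of X^0 Y^j vanish): shift in X
  divX : PS2 → PS2
  divX g i j = g (suc i) j

  diffQuot : PS1 → PS2
  diffQuot f = divX (substXplusY f -PS2 substY f)

  record IsDerivation (D : Ser → Ser) : Set (c ⊔ ℓ) where
    field
      cong    : ∀ {F G} → F ≈R G → D F ≈R D G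
      additive : ∀ F G → D (F +R G) ≈R D F +R D G
      homog   : ∀ a F → D (a ·R F) ≈R a ·R D F
      leibniz : ∀ F G → D (F *R G) ≈R D F *R G +R F *R D G

{-# OPTIONS --safe #-}
-- The Leibniz rule gives D ∘ ad_𝔱 = ad_𝔱 ∘ D + ad_{D 𝔱}; iterating, with Jacobi and Pascal's rule,
-- D (ad_𝔱^i B) = ad_𝔱^i (D B) + Σ_{a+b=i-1} C(i, a+1) [ad_𝔱^a (D 𝔱), ad_𝔱^b B]; weighting by f_i and
-- collecting along the diagonals a + b = s gives the coefficients of (f(X+Y) − f(Y))/X.
-- D is only known to commute with finite sums, but writing H = 𝔱 H₁ + A H₂ shows that D lowers the
-- order of a series by at most one, so the coefficient of D (f(ad_𝔱) B) at a word w only sees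
-- the terms i ≤ |w| + 2 of f(ad_𝔱) B.
module Submission where

open import Defs
open import Algebra.Bundles using (CommutativeRing)
open import Data.Maybe using (nothing)
open import Data.Nat using (ℕ; zero; suc; _∸_; _≤_; _<_; z≤n; s≤s)
import Data.Nat as ℕ
import Data.Nat.Properties as ℕₚ
open import Data.List using ([]; _∷_; length)
open import Data.List.Properties using (map-∘)
open import Data.Sum using (inj₁; inj₂)
open import Function using (_∘_)
open import Relation.Binary.PropositionalEquality as ≡ using (_≡_)
import Tactic.RingSolver.Core.AlmostCommutativeRing as ACR
open import Tactic.RingSolver using (solve-∀)

module Rearrange {c ℓ} (K : CommutativeRing c ℓ) where
  almostCommutativeRing : ACR.AlmostCommutativeRing c ℓ
  almostCommutativeRing = ACR.fromCommutativeRing K (λ _ → nothing)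

  open ACR.AlmostCommutativeRing almostCommutativeRing

  [a+b]-[c+d]≈[a-d]+[b-c] : ∀ a b c d → (a + b) - (c + d) ≈ (a - d) + (b - c)
  [a+b]-[c+d]≈[a-d]+[b-c] = solve-∀ almostCommutativeRing

  [a+b]-[c+d]≈[a-c]+[b-d] : ∀ a b c d → (a + b) - (c + d) ≈ (a - c) + (b - d)
  [a+b]-[c+d]≈[a-c]+[b-d] = solve-∀ almostCommutativeRing

module Series {c ℓ} (K : CommutativeRing c ℓ) where
  open CommutativeRing K hiding (zero)
  open import Algebra.Properties.Ring ring using (-0#≈0#; -1*x≈-x; -‿distribˡ-*; -‿distribʳ-*)
  open import Algebra.Properties.AbelianGroup +-abelianGroup using (⁻¹-∙-comm)
  open import Algebra.Properties.Group +-group using (x∙y⁻¹≈ε⇒x≈y; x≈y⇒x∙y⁻¹≈ε)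
  open import Algebra.Properties.CommutativeSemigroup +-commutativeSemigroup
    using () renaming (interchange to +-interchange; x∙yz≈y∙xz to x+[y+z]≈y+[x+z])
  open import Algebra.Properties.CommutativeSemigroup *-commutativeSemigroup
    using () renaming (x∙yz≈y∙xz to x*[y*z]≈y*[x*z])
  open NCPS K
  open import Relation.Binary.Reasoning.Setoid setoid

  open Rearrange K

  *-zero-congʳ : ∀ {x} a → x ≈ 0# → a * x ≈ 0#
  *-zero-congʳ a x≈0 = trans (*-congˡ x≈0) (zeroʳ a)

  x-0≈x : ∀ x → x - 0# ≈ x
  x-0≈x x = trans (+-congˡ -0#≈0#) (+-identityʳ x)

  -‿cong-sub : ∀ {a b c d} → a ≈ b → c ≈ d → a - c ≈ b - d
  -‿cong-sub a≈b c≈d = +-cong a≈b (-‿cong c≈d)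

  -- Finite sums

  sumUpTo-cong : ∀ n {F G : ℕ → Carrier} → (∀ i → i ≤ n → F i ≈ G i) → sumUpTo n F ≈ sumUpTo n G
  sumUpTo-cong zero F≈G = F≈G 0 z≤n
  sumUpTo-cong (suc n) F≈G =
    +-cong (sumUpTo-cong n (λ i i≤n → F≈G i (ℕₚ.m≤n⇒m≤1+n i≤n))) (F≈G (suc n) ℕₚ.≤-refl)

  sumUpTo-+ : ∀ n (F G : ℕ → Carrier) → sumUpTo n (λ i → F i + G i) ≈ sumUpTo n F + sumUpTo n G
  sumUpTo-+ zero F G = refl
  sumUpTo-+ (suc n) F G = trans (+-congʳ (sumUpTo-+ n F G)) (+-interchange _ _ _ _)

  *-distribˡ-sumUpTo : ∀ n a (F : ℕ → Carrier) → a * sumUpTo n F ≈ sumUpTo n (λ i → a * F i)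
  *-distribˡ-sumUpTo zero a F = refl
  *-distribˡ-sumUpTo (suc n) a F = trans (distribˡ a _ _) (+-congʳ (*-distribˡ-sumUpTo n a F))

  sumUpTo-zero : ∀ n (F : ℕ → Carrier) → (∀ i → i ≤ n → F i ≈ 0#) → sumUpTo n F ≈ 0#
  sumUpTo-zero n F F≈0 = trans (sumUpTo-cong n F≈0) (sumUpTo-zero′ n)
    where
      sumUpTo-zero′ : ∀ n → sumUpTo n (λ _ → 0#) ≈ 0#
      sumUpTo-zero′ zero = refl
      sumUpTo-zero′ (suc n) = trans (+-congʳ (sumUpTo-zero′ n)) (+-identityʳ 0#)

  sumUpTo-truncate : ∀ {L} n (F : ℕ → Carrier) → L ≤ n → (∀ i → L < i → F i ≈ 0#) →
                     sumUpTo n F ≈ sumUpTo L F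
  sumUpTo-truncate zero F z≤n F≈0 = refl
  sumUpTo-truncate (suc n) F L≤1+n F≈0 with ℕₚ.m≤n⇒m<n∨m≡n L≤1+n
  ... | inj₂ ≡.refl = refl
  ... | inj₁ (s≤s L≤n) =
    trans (+-cong (sumUpTo-truncate n F L≤n F≈0) (F≈0 (suc n) (s≤s L≤n))) (+-identityʳ _)

  sumUpTo-suc-head : ∀ n (F : ℕ → Carrier) → sumUpTo (suc n) F ≈ F 0 + sumUpTo n (λ i → F (suc i))
  sumUpTo-suc-head zero F = refl
  sumUpTo-suc-head (suc n) F = trans (+-congʳ (sumUpTo-suc-head n F)) (+-assoc _ _ _)

  sumUpTo-diagonals : ∀ n (h : ℕ → ℕ → Carrier) →
    sumUpTo n (λ s → sumUpTo s (λ a → h a (s ∸ a))) ≈ sumUpTo n (λ i → sumUpTo (n ∸ i) (h i))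
  sumUpTo-diagonals zero h = refl
  sumUpTo-diagonals (suc n) h = begin
      sumUpTo n (λ s → sumUpTo s (λ a → h a (s ∸ a))) + sumUpTo (suc n) (λ a → h a (suc n ∸ a))
        ≈⟨ +-cong (sumUpTo-diagonals n h)
                  (+-cong (sumUpTo-cong n (λ a a≤n → reflexive (≡.cong (h a) (ℕₚ.+-∸-assoc 1 a≤n))))
                          (reflexive (≡.cong (h (suc n)) (ℕₚ.n∸n≡0 n)))) ⟩
      sumUpTo n (λ i → sumUpTo (n ∸ i) (h i)) + (sumUpTo n (λ i → h i (suc (n ∸ i))) + h (suc n) 0)
        ≈⟨ sym (+-assoc _ _ _) ⟩
      (sumUpTo n (λ i → sumUpTo (n ∸ i) (h i)) + sumUpTo n (λ i → h i (suc (n ∸ i)))) + h (suc n) 0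
        ≈⟨ +-cong (sym (sumUpTo-+ n _ _))
                  (reflexive (≡.cong (λ m → sumUpTo m (h (suc n))) (≡.sym (ℕₚ.n∸n≡0 n)))) ⟩
      sumUpTo n (λ i → sumUpTo (suc (n ∸ i)) (h i)) + sumUpTo (n ∸ n) (h (suc n))
        ≈⟨ +-congʳ (sumUpTo-cong n (λ i i≤n →
             reflexive (≡.cong (λ m → sumUpTo m (h i)) (≡.sym (ℕₚ.+-∸-assoc 1 i≤n))))) ⟩
      sumUpTo (suc n) (λ i → sumUpTo (suc n ∸ i) (h i)) ∎

  fromℕ-+ : ∀ m n → fromℕ (m ℕ.+ n) ≈ fromℕ m + fromℕ n
  fromℕ-+ zero n = sym (+-identityˡ _)
  fromℕ-+ (suc m) n = trans (+-congˡ (fromℕ-+ m n)) (sym (+-assoc _ _ _))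

  fromℕ-1 : fromℕ 1 ≈ 1#
  fromℕ-1 = +-identityʳ 1#

  binom-< : ∀ n k → n < k → binom n k ≡ 0
  binom-< zero (suc k) n<k = ≡.refl
  binom-< (suc n) (suc k) (s≤s n<k) =
    ≡.cong₂ ℕ._+_ (binom-< n k n<k) (binom-< n (suc k) (ℕₚ.m≤n⇒m≤1+n n<k))

  -- Pascal's rule C(k+2, a+1) = C(k+1, a) + C(k+1, a+1), with the a = 0 and a = k+1 terms split off.
  sumUpTo-pascal : ∀ k (c : ℕ → ℕ → Carrier) →
    c 0 (suc k) + sumUpTo k (λ a → fromℕ (binom (suc k) (suc a)) * (c (suc a) (k ∸ a) + c a (suc (k ∸ a))))
    ≈ sumUpTo (suc k) (λ a → fromℕ (binom (suc (suc k)) (suc a)) * c a (suc k ∸ a))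
  sumUpTo-pascal k c = sym (begin
      sumUpTo (suc k) (λ a → fromℕ (binom (suc (suc k)) (suc a)) * c a (suc k ∸ a))
        ≈⟨ sumUpTo-cong (suc k) (λ a _ →
             trans (*-congʳ (fromℕ-+ (binom (suc k) a) (binom (suc k) (suc a)))) (distribʳ _ _ _)) ⟩
      sumUpTo (suc k) (λ a → C a a * c a (suc k ∸ a) + C (suc a) a * c a (suc k ∸ a))
        ≈⟨ sumUpTo-+ (suc k) _ _ ⟩
      sumUpTo (suc k) (λ a → C a a * c a (suc k ∸ a)) + sumUpTo (suc k) (λ a → C (suc a) a * c a (suc k ∸ a))
        ≈⟨ +-cong (trans (sumUpTo-suc-head k _) (+-congʳ (trans (*-congʳ fromℕ-1) (*-identityˡ _)))) lastVanishes ⟩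
      (c 0 (suc k) + Y₁) + (Y₂ + 0#)
        ≈⟨ trans (+-congˡ (+-identityʳ Y₂)) (+-assoc _ _ _) ⟩
      c 0 (suc k) + (Y₁ + Y₂)
        ≈⟨ +-congˡ (trans (sym (sumUpTo-+ k _ _)) (sumUpTo-cong k (λ a _ → sym (distribˡ _ _ _)))) ⟩
      c 0 (suc k) + sumUpTo k (λ a → C (suc a) a * (c (suc a) (k ∸ a) + c a (suc (k ∸ a)))) ∎)
    where
      C : ℕ → ℕ → Carrier
      C b a = fromℕ (binom (suc k) b)
      Y₁ = sumUpTo k (λ a → C (suc a) a * c (suc a) (k ∸ a))
      Y₂ = sumUpTo k (λ a → C (suc a) a * c a (suc (k ∸ a)))
      lastVanishes : sumUpTo (suc k) (λ a → C (suc a) a * c a (suc k ∸ a)) ≈ Y₂ + 0#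
      lastVanishes =
        +-cong (sumUpTo-cong k (λ a a≤k → *-congˡ (reflexive (≡.cong (c a) (ℕₚ.+-∸-assoc 1 a≤k)))))
               (trans (*-congʳ (reflexive (≡.cong fromℕ (binom-< (suc k) (suc (suc k)) ℕₚ.≤-refl)))) (zeroˡ _))

  -- The Cauchy product

  shift : Letter → Ser → Ser
  shift x F w = F (x ∷ w)

  *R-[] : ∀ F G → (F *R G) [] ≈ F [] * G []
  *R-[] F G = +-identityʳ _

  *R-∷ : ∀ F G x w → (F *R G) (x ∷ w) ≈ F [] * G (x ∷ w) + (shift x F *R G) w
  *R-∷ F G x w = reflexive (≡.cong (λ t → F [] * G (x ∷ w) + sumL t) (≡.sym (map-∘ (splits w))))

  *R-cong : ∀ {F F′ G G′} → F ≈R F′ → G ≈R G′ → F *R G ≈R F′ *R G′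
  *R-cong {F} {F′} {G} {G′} F≈F′ G≈G′ [] =
    trans (*R-[] F G) (trans (*-cong (F≈F′ []) (G≈G′ [])) (sym (*R-[] F′ G′)))
  *R-cong {F} {F′} {G} {G′} F≈F′ G≈G′ (x ∷ w) =
    trans (*R-∷ F G x w)
      (trans (+-cong (*-cong (F≈F′ []) (G≈G′ (x ∷ w))) (*R-cong (F≈F′ ∘ (x ∷_)) G≈G′ w))
             (sym (*R-∷ F′ G′ x w)))

  *R-distribʳ-+R : ∀ F G H → (F +R G) *R H ≈R F *R H +R G *R H
  *R-distribʳ-+R F G H [] =
    trans (*R-[] (F +R G) H) (trans (distribʳ _ _ _) (sym (+-cong (*R-[] F H) (*R-[] G H))))
  *R-distribʳ-+R F G H (x ∷ w) = begin
    ((F +R G) *R H) (x ∷ w)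
      ≈⟨ *R-∷ (F +R G) H x w ⟩
    (F [] + G []) * H (x ∷ w) + ((shift x F +R shift x G) *R H) w
      ≈⟨ +-cong (distribʳ _ _ _) (*R-distribʳ-+R (shift x F) (shift x G) H w) ⟩
    (F [] * H (x ∷ w) + G [] * H (x ∷ w)) + ((shift x F *R H) w + (shift x G *R H) w)
      ≈⟨ +-interchange _ _ _ _ ⟩
    (F [] * H (x ∷ w) + (shift x F *R H) w) + (G [] * H (x ∷ w) + (shift x G *R H) w)
      ≈⟨ sym (+-cong (*R-∷ F H x w) (*R-∷ G H x w)) ⟩
    (F *R H) (x ∷ w) + (G *R H) (x ∷ w) ∎

  *R-distribˡ-+R : ∀ F G H → F *R (G +R H) ≈R F *R G +R F *R H
  *R-distribˡ-+R F G H [] =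
    trans (*R-[] F (G +R H)) (trans (distribˡ _ _ _) (sym (+-cong (*R-[] F G) (*R-[] F H))))
  *R-distribˡ-+R F G H (x ∷ w) = begin
    (F *R (G +R H)) (x ∷ w)
      ≈⟨ *R-∷ F (G +R H) x w ⟩
    F [] * (G (x ∷ w) + H (x ∷ w)) + (shift x F *R (G +R H)) w
      ≈⟨ +-cong (distribˡ _ _ _) (*R-distribˡ-+R (shift x F) G H w) ⟩
    (F [] * G (x ∷ w) + F [] * H (x ∷ w)) + ((shift x F *R G) w + (shift x F *R H) w)
      ≈⟨ +-interchange _ _ _ _ ⟩
    (F [] * G (x ∷ w) + (shift x F *R G) w) + (F [] * H (x ∷ w) + (shift x F *R H) w)
      ≈⟨ sym (+-cong (*R-∷ F G x w) (*R-∷ F H x w)) ⟩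
    (F *R G) (x ∷ w) + (F *R H) (x ∷ w) ∎

  -R‿distribˡ-*R : ∀ F G → (-R F) *R G ≈R -R (F *R G)
  -R‿distribˡ-*R F G [] =
    trans (*R-[] (-R F) G) (trans (sym (-‿distribˡ-* _ _)) (-‿cong (sym (*R-[] F G))))
  -R‿distribˡ-*R F G (x ∷ w) =
    trans (*R-∷ (-R F) G x w)
      (trans (+-cong (sym (-‿distribˡ-* _ _)) (-R‿distribˡ-*R (shift x F) G w))
             (trans (⁻¹-∙-comm _ _) (-‿cong (sym (*R-∷ F G x w)))))

  -R‿distribʳ-*R : ∀ F G → F *R (-R G) ≈R -R (F *R G)
  -R‿distribʳ-*R F G [] =
    trans (*R-[] F (-R G)) (trans (sym (-‿distribʳ-* _ _)) (-‿cong (sym (*R-[] F G))))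
  -R‿distribʳ-*R F G (x ∷ w) =
    trans (*R-∷ F (-R G) x w)
      (trans (+-cong (sym (-‿distribʳ-* _ _)) (-R‿distribʳ-*R (shift x F) G w))
             (trans (⁻¹-∙-comm _ _) (-‿cong (sym (*R-∷ F G x w)))))

  *R-·R-assocˡ : ∀ a F G → (a ·R F) *R G ≈R a ·R (F *R G)
  *R-·R-assocˡ a F G [] = trans (*R-[] (a ·R F) G) (trans (*-assoc _ _ _) (*-congˡ (sym (*R-[] F G))))
  *R-·R-assocˡ a F G (x ∷ w) =
    trans (*R-∷ (a ·R F) G x w)
      (trans (+-cong (*-assoc _ _ _) (*R-·R-assocˡ a (shift x F) G w))
             (trans (sym (distribˡ _ _ _)) (*-congˡ (sym (*R-∷ F G x w)))))

  *R-·R-assocʳ : ∀ a F G → F *R (a ·R G) ≈R a ·R (F *R G)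
  *R-·R-assocʳ a F G [] = trans (*R-[] F (a ·R G)) (trans (x*[y*z]≈y*[x*z] _ _ _) (*-congˡ (sym (*R-[] F G))))
  *R-·R-assocʳ a F G (x ∷ w) =
    trans (*R-∷ F (a ·R G) x w)
      (trans (+-cong (x*[y*z]≈y*[x*z] _ _ _) (*R-·R-assocʳ a (shift x F) G w))
             (trans (sym (distribˡ _ _ _)) (*-congˡ (sym (*R-∷ F G x w)))))

  *R-zeroˡ : ∀ G → 0R *R G ≈R 0R
  *R-zeroˡ G [] = trans (*R-[] 0R G) (zeroˡ _)
  *R-zeroˡ G (x ∷ w) = trans (*R-∷ 0R G x w) (trans (+-cong (zeroˡ _) (*R-zeroˡ G w)) (+-identityʳ 0#))

  *R-zeroʳ : ∀ F → F *R 0R ≈R 0R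
  *R-zeroʳ F [] = trans (*R-[] F 0R) (zeroʳ _)
  *R-zeroʳ F (x ∷ w) = trans (*R-∷ F 0R x w) (trans (+-cong (zeroʳ _) (*R-zeroʳ (shift x F) w)) (+-identityʳ 0#))

  *R-identityˡ : ∀ G → 1R *R G ≈R G
  *R-identityˡ G [] = trans (*R-[] 1R G) (*-identityˡ _)
  *R-identityˡ G (x ∷ w) =
    trans (*R-∷ 1R G x w) (trans (+-cong (*-identityˡ _) (*R-zeroˡ G w)) (+-identityʳ _))

  *R-assoc : ∀ F G H → (F *R G) *R H ≈R F *R (G *R H)
  *R-assoc F G H [] = begin
    ((F *R G) *R H) [] ≈⟨ trans (*R-[] (F *R G) H) (*-congʳ (*R-[] F G)) ⟩
    (F [] * G []) * H [] ≈⟨ *-assoc _ _ _ ⟩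
    F [] * (G [] * H []) ≈⟨ sym (trans (*R-[] F (G *R H)) (*-congˡ (*R-[] G H))) ⟩
    (F *R (G *R H)) [] ∎
  *R-assoc F G H (x ∷ w) = begin
    ((F *R G) *R H) (x ∷ w)
      ≈⟨ *R-∷ (F *R G) H x w ⟩
    (F *R G) [] * H (x ∷ w) + (shift x (F *R G) *R H) w
      ≈⟨ +-cong (*-congʳ (*R-[] F G)) (*R-cong (*R-∷ F G x) (λ _ → refl) w) ⟩
    (F [] * G []) * H (x ∷ w) + ((F [] ·R shift x G +R shift x F *R G) *R H) w
      ≈⟨ +-congˡ (*R-distribʳ-+R _ _ H w) ⟩
    (F [] * G []) * H (x ∷ w) + (((F [] ·R shift x G) *R H) w + ((shift x F *R G) *R H) w)
      ≈⟨ +-congˡ (+-cong (*R-·R-assocˡ (F []) (shift x G) H w) (*R-assoc (shift x F) G H w)) ⟩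
    (F [] * G []) * H (x ∷ w) + (F [] * (shift x G *R H) w + (shift x F *R (G *R H)) w)
      ≈⟨ trans (sym (+-assoc _ _ _)) (+-congʳ (trans (+-congʳ (*-assoc _ _ _)) (sym (distribˡ _ _ _)))) ⟩
    F [] * (G [] * H (x ∷ w) + (shift x G *R H) w) + (shift x F *R (G *R H)) w
      ≈⟨ +-congʳ (*-congˡ (sym (*R-∷ G H x w))) ⟩
    F [] * (G *R H) (x ∷ w) + (shift x F *R (G *R H)) w
      ≈⟨ sym (*R-∷ F (G *R H) x w) ⟩
    (F *R (G *R H)) (x ∷ w) ∎

  *R-distribʳ-‿R : ∀ F G H → (F -R G) *R H ≈R F *R H -R G *R H
  *R-distribʳ-‿R F G H w = trans (*R-distribʳ-+R F (-R G) H w) (+-congˡ (-R‿distribˡ-*R G H w))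

  *R-distribˡ-‿R : ∀ H F G → H *R (F -R G) ≈R H *R F -R H *R G
  *R-distribˡ-‿R H F G w = trans (*R-distribˡ-+R H F (-R G) w) (+-congˡ (-R‿distribʳ-*R H G w))

  -- Commutators

  sumR : ℕ → (ℕ → Ser) → Ser
  sumR n Fs w = sumUpTo n (λ i → Fs i w)

  -‿telescope : ∀ a b d → (a - b) + (b - d) ≈ a - d
  -‿telescope a b d = begin
    (a - b) + (b - d) ≈⟨ trans (+-assoc a (- b) _) (+-congˡ (sym (+-assoc (- b) b (- d)))) ⟩
    a + ((- b + b) - d) ≈⟨ +-congˡ (trans (+-congʳ (-‿inverseˡ b)) (+-identityˡ (- d))) ⟩
    a - d ∎

  []R-cong : ∀ {F F′ G G′} → F ≈R F′ → G ≈R G′ → [ F , G ]R ≈R [ F′ , G′ ]R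
  []R-cong F≈F′ G≈G′ w = -‿cong-sub (*R-cong F≈F′ G≈G′ w) (*R-cong G≈G′ F≈F′ w)

  []R-+ʳ : ∀ T F G → [ T , F +R G ]R ≈R [ T , F ]R +R [ T , G ]R
  []R-+ʳ T F G w =
    trans (-‿cong-sub (*R-distribˡ-+R T F G w) (*R-distribʳ-+R F G T w)) ([a+b]-[c+d]≈[a-c]+[b-d] _ _ _ _)

  []R-negʳ : ∀ T F → [ T , -R F ]R ≈R -R [ T , F ]R
  []R-negʳ T F w =
    trans (-‿cong-sub (-R‿distribʳ-*R T F w) (-R‿distribˡ-*R F T w)) (⁻¹-∙-comm _ _)

  []R-‿ʳ : ∀ T F G → [ T , F -R G ]R ≈R [ T , F ]R -R [ T , G ]R
  []R-‿ʳ T F G w = trans ([]R-+ʳ T F (-R G) w) (+-congˡ ([]R-negʳ T G w))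

  []R-·ʳ : ∀ T a F → [ T , a ·R F ]R ≈R a ·R [ T , F ]R
  []R-·ʳ T a F w = trans (-‿cong-sub (*R-·R-assocʳ a T F w) (*R-·R-assocˡ a F T w))
                      (trans (+-congˡ (-‿distribʳ-* _ _)) (sym (distribˡ a _ _)))

  []R-0ʳ : ∀ T → [ T , 0R ]R ≈R 0R
  []R-0ʳ T w = x≈y⇒x∙y⁻¹≈ε (trans (*R-zeroʳ T w) (sym (*R-zeroˡ T w)))

  []R-sumRʳ : ∀ T n Fs → [ T , sumR n Fs ]R ≈R sumR n (λ i → [ T , Fs i ]R)
  []R-sumRʳ T zero Fs w = refl
  []R-sumRʳ T (suc n) Fs w = trans ([]R-+ʳ T (sumR n Fs) (Fs (suc n)) w) (+-congʳ ([]R-sumRʳ T n Fs w))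

  []R-*R-leibniz : ∀ T X Y → [ T , X *R Y ]R ≈R [ T , X ]R *R Y +R X *R [ T , Y ]R
  []R-*R-leibniz T X Y w = sym (begin
    ([ T , X ]R *R Y +R X *R [ T , Y ]R) w
      ≈⟨ +-cong (*R-distribʳ-‿R (T *R X) (X *R T) Y w) (*R-distribˡ-‿R X (T *R Y) (Y *R T) w) ⟩
    (((T *R X) *R Y) w - ((X *R T) *R Y) w) + ((X *R (T *R Y)) w - (X *R (Y *R T)) w)
      ≈⟨ +-cong (-‿cong-sub (*R-assoc T X Y w) (*R-assoc X T Y w)) (+-congˡ (-‿cong (sym (*R-assoc X Y T w)))) ⟩
    ((T *R (X *R Y)) w - (X *R (T *R Y)) w) + ((X *R (T *R Y)) w - ((X *R Y) *R T) w)
      ≈⟨ -‿telescope _ _ _ ⟩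
    [ T , X *R Y ]R w ∎)

  jacobi : ∀ T X Y → [ T , [ X , Y ]R ]R ≈R [ [ T , X ]R , Y ]R +R [ X , [ T , Y ]R ]R
  jacobi T X Y w = begin
    [ T , [ X , Y ]R ]R w
      ≈⟨ []R-‿ʳ T (X *R Y) (Y *R X) w ⟩
    [ T , X *R Y ]R w - [ T , Y *R X ]R w
      ≈⟨ -‿cong-sub ([]R-*R-leibniz T X Y w) ([]R-*R-leibniz T Y X w) ⟩
    (([ T , X ]R *R Y) w + (X *R [ T , Y ]R) w) - (([ T , Y ]R *R X) w + (Y *R [ T , X ]R) w)
      ≈⟨ [a+b]-[c+d]≈[a-d]+[b-c] _ _ _ _ ⟩
    ([ [ T , X ]R , Y ]R +R [ X , [ T , Y ]R ]R) w ∎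

  -- Order of a series

  VanishesBelow : ℕ → Ser → Set ℓ
  VanishesBelow k F = ∀ w → length w < k → F w ≈ 0#

  vanishesBelow-0 : ∀ F → VanishesBelow 0 F
  vanishesBelow-0 F w ()

  vanishesBelow-resp : ∀ {k F G} → F ≈R G → VanishesBelow k F → VanishesBelow k G
  vanishesBelow-resp F≈G F≈0 w lt = trans (sym (F≈G w)) (F≈0 w lt)

  vanishesBelow-+R : ∀ {k F G} → VanishesBelow k F → VanishesBelow k G → VanishesBelow k (F +R G)
  vanishesBelow-+R F≈0 G≈0 w lt = trans (+-cong (F≈0 w lt) (G≈0 w lt)) (+-identityʳ 0#)

  vanishesBelow-neg : ∀ {k F} → VanishesBelow k F → VanishesBelow k (-R F)
  vanishesBelow-neg F≈0 w lt = trans (-‿cong (F≈0 w lt)) -0#≈0#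

  vanishesBelow-*R : ∀ a {b} F G → VanishesBelow a F → VanishesBelow b G → VanishesBelow (a ℕ.+ b) (F *R G)
  vanishesBelow-*R zero F G F≈0 G≈0 [] lt = trans (*R-[] F G) (*-zero-congʳ _ (G≈0 [] lt))
  vanishesBelow-*R (suc a) F G F≈0 G≈0 [] lt = trans (*R-[] F G) (trans (*-congʳ (F≈0 [] (s≤s z≤n))) (zeroˡ _))
  vanishesBelow-*R zero F G F≈0 G≈0 (x ∷ w) lt =
    trans (*R-∷ F G x w)
      (trans (+-cong (*-zero-congʳ _ (G≈0 (x ∷ w) lt))
                     (vanishesBelow-*R zero (shift x F) G (vanishesBelow-0 _) G≈0 w (ℕₚ.<-trans (ℕₚ.n<1+n _) lt)))
             (+-identityʳ 0#))
  vanishesBelow-*R (suc a) F G F≈0 G≈0 (x ∷ w) (s≤s lt) =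
    trans (*R-∷ F G x w)
      (trans (+-cong (trans (*-congʳ (F≈0 [] (s≤s z≤n))) (zeroˡ _))
                     (vanishesBelow-*R a (shift x F) G (λ u lt′ → F≈0 (x ∷ u) (s≤s lt′)) G≈0 w lt))
             (+-identityʳ 0#))

  vanishesBelow-[]R : ∀ {a b F G} → VanishesBelow a F → VanishesBelow b G → VanishesBelow (a ℕ.+ b) [ F , G ]R
  vanishesBelow-[]R {a} {b} {F} {G} F≈0 G≈0 =
    vanishesBelow-+R (vanishesBelow-*R a F G F≈0 G≈0)
      (vanishesBelow-neg (≡.subst (λ k → VanishesBelow k (G *R F)) (ℕₚ.+-comm b a)
                                  (vanishesBelow-*R b G F G≈0 F≈0)))

  𝔱R-vanishesBelow-1 : VanishesBelow 1 𝔱R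
  𝔱R-vanishesBelow-1 [] _ = refl
  𝔱R-vanishesBelow-1 (_ ∷ _) (s≤s ())

  AR-vanishesBelow-1 : VanishesBelow 1 AR
  AR-vanishesBelow-1 [] _ = refl
  AR-vanishesBelow-1 (_ ∷ _) (s≤s ())

  ad𝔱^-vanishesBelow : ∀ k F → VanishesBelow k (ad𝔱^ k F)
  ad𝔱^-vanishesBelow zero F = vanishesBelow-0 F
  ad𝔱^-vanishesBelow (suc k) F = vanishesBelow-[]R 𝔱R-vanishesBelow-1 (ad𝔱^-vanishesBelow k F)

  *R-∷-constantTerm-0 : ∀ F G x w → F [] ≈ 0# → (F *R G) (x ∷ w) ≈ (shift x F *R G) w
  *R-∷-constantTerm-0 F G x w F[]≈0 =
    trans (*R-∷ F G x w) (trans (+-congʳ (trans (*-congʳ F[]≈0) (zeroˡ _))) (+-identityˡ _))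

  decompose : ∀ H → H [] ≈ 0# → H ≈R 𝔱R *R shift 𝔱 H +R AR *R shift 𝔸 H
  decompose H H[]≈0 [] =
    trans H[]≈0 (sym (trans (+-cong (trans (*R-[] 𝔱R (shift 𝔱 H)) (zeroˡ _))
                                    (trans (*R-[] AR (shift 𝔸 H)) (zeroˡ _)))
                            (+-identityʳ 0#)))
  decompose H _ (𝔱 ∷ w) = sym (begin
    (𝔱R *R shift 𝔱 H) (𝔱 ∷ w) + (AR *R shift 𝔸 H) (𝔱 ∷ w)
      ≈⟨ +-cong (*R-∷-constantTerm-0 𝔱R _ 𝔱 w refl) (*R-∷-constantTerm-0 AR _ 𝔱 w refl) ⟩
    (shift 𝔱 𝔱R *R shift 𝔱 H) w + (shift 𝔱 AR *R shift 𝔸 H) w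
      ≈⟨ +-cong (*R-cong (λ { [] → refl ; (_ ∷ _) → refl }) (λ _ → refl) w)
                (*R-cong (λ _ → refl) (λ _ → refl) w) ⟩
    (1R *R shift 𝔱 H) w + (0R *R shift 𝔸 H) w
      ≈⟨ trans (+-cong (*R-identityˡ _ w) (*R-zeroˡ _ w)) (+-identityʳ _) ⟩
    H (𝔱 ∷ w) ∎)
  decompose H _ (𝔸 ∷ w) = sym (begin
    (𝔱R *R shift 𝔱 H) (𝔸 ∷ w) + (AR *R shift 𝔸 H) (𝔸 ∷ w)
      ≈⟨ +-cong (*R-∷-constantTerm-0 𝔱R _ 𝔸 w refl) (*R-∷-constantTerm-0 AR _ 𝔸 w refl) ⟩
    (shift 𝔸 𝔱R *R shift 𝔱 H) w + (shift 𝔸 AR *R shift 𝔸 H) w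
      ≈⟨ +-cong (*R-cong (λ _ → refl) (λ _ → refl) w)
                (*R-cong (λ { [] → refl ; (_ ∷ _) → refl }) (λ _ → refl) w) ⟩
    (0R *R shift 𝔱 H) w + (1R *R shift 𝔸 H) w
      ≈⟨ trans (+-cong (*R-zeroˡ _ w) (*R-identityˡ _ w)) (+-identityˡ _) ⟩
    H (𝔸 ∷ w) ∎)

  evalAd≈sumR : ∀ f B m w → length w ≤ m → evalAd f B w ≈ sumR m (λ i → f i ·R ad𝔱^ i B) w
  evalAd≈sumR f B m w lw≤m =
    sym (sumUpTo-truncate m _ lw≤m (λ i lw<i → *-zero-congʳ (f i) (ad𝔱^-vanishesBelow i B w lw<i)))

  module Derivation (D : Ser → Ser) (isD : IsDerivation D) where
    open IsDerivation isD renaming (cong to D-cong)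

    D-neg : ∀ F → D (-R F) ≈R -R D F
    D-neg F w =
      trans (D-cong {G = (- 1#) ·R F} (λ u → sym (-1*x≈-x (F u))) w) (trans (homog (- 1#) F w) (-1*x≈-x _))

    D-‿ : ∀ F G → D (F -R G) ≈R D F -R D G
    D-‿ F G w = trans (additive F (-R G) w) (+-congˡ (D-neg G w))

    D-[]R : ∀ F G → D [ F , G ]R ≈R [ D F , G ]R +R [ F , D G ]R
    D-[]R F G w =
      trans (D-‿ (F *R G) (G *R F) w)
            (trans (-‿cong-sub (leibniz F G w) (leibniz G F w)) ([a+b]-[c+d]≈[a-d]+[b-c] _ _ _ _))

    D-sumR : ∀ n Fs → D (sumR n Fs) ≈R sumR n (D ∘ Fs)
    D-sumR zero Fs w = refl
    D-sumR (suc n) Fs w = trans (additive (sumR n Fs) (Fs (suc n)) w) (+-congʳ (D-sumR n Fs w))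

    D-vanishesBelow : ∀ k H → VanishesBelow (suc k) H → VanishesBelow k (D H)
    D-vanishesBelow zero H _ = vanishesBelow-0 _
    D-vanishesBelow (suc k) H H≈0 = vanishesBelow-resp (λ w → sym (D-decompose w)) expansion≈0
      where
        H₁ = shift 𝔱 H
        H₂ = shift 𝔸 H
        H₁≈0 : VanishesBelow (suc k) H₁
        H₁≈0 u lt = H≈0 (𝔱 ∷ u) (s≤s lt)
        H₂≈0 : VanishesBelow (suc k) H₂
        H₂≈0 u lt = H≈0 (𝔸 ∷ u) (s≤s lt)
        expansion : Ser
        expansion = (D 𝔱R *R H₁ +R 𝔱R *R D H₁) +R (D AR *R H₂ +R AR *R D H₂)
        D-decompose : D H ≈R expansion
        D-decompose w = trans (D-cong (decompose H (H≈0 [] (s≤s z≤n))) w)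
                          (trans (additive _ _ w) (+-cong (leibniz 𝔱R H₁ w) (leibniz AR H₂ w)))
        expansion≈0 : VanishesBelow (suc k) expansion
        expansion≈0 =
          vanishesBelow-+R
            (vanishesBelow-+R (vanishesBelow-*R 0 _ _ (vanishesBelow-0 _) H₁≈0)
                              (vanishesBelow-*R 1 _ _ 𝔱R-vanishesBelow-1 (D-vanishesBelow k H₁ H₁≈0)))
            (vanishesBelow-+R (vanishesBelow-*R 0 _ _ (vanishesBelow-0 _) H₂≈0)
                              (vanishesBelow-*R 1 _ _ AR-vanishesBelow-1 (D-vanishesBelow k H₂ H₂≈0)))

    D-local : ∀ F G w → (∀ v → length v ≤ suc (length w) → F v ≈ G v) → D F w ≈ D G w
    D-local F G w F≈G = x∙y⁻¹≈ε⇒x≈y _ _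
      (trans (sym (D-‿ F G w)) (D-vanishesBelow (suc (length w)) (F -R G) F-G≈0 w ℕₚ.≤-refl))
      where
        F-G≈0 : VanishesBelow (suc (suc (length w))) (F -R G)
        F-G≈0 v lt = x≈y⇒x∙y⁻¹≈ε (F≈G v (ℕₚ.≤-pred lt))

    module _ (B : Ser) where
      bracketTerm : ℕ → ℕ → Ser
      bracketTerm a b = [ ad𝔱^ a (D 𝔱R) , ad𝔱^ b B ]R

      -- defect i = ((X + Y)^i − Y^i)/X [[D 𝔱, B]]_𝔱, a finite sum.
      defect : ℕ → Ser
      defect zero = 0R
      defect (suc i) = sumR i (λ a → fromℕ (binom (suc i) (suc a)) ·R bracketTerm a (i ∸ a))

      defect-suc : ∀ i → bracketTerm 0 i +R ad𝔱 (defect i) ≈R defect (suc i)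
      defect-suc zero w =
        trans (+-congˡ ([]R-0ʳ 𝔱R w)) (trans (+-identityʳ _) (sym (trans (*-congʳ fromℕ-1) (*-identityˡ _))))
      defect-suc (suc k) w = begin
        bracketTerm 0 (suc k) w + ad𝔱 (defect (suc k)) w
          ≈⟨ +-congˡ (trans ([]R-sumRʳ 𝔱R k _ w)
                        (sumUpTo-cong k (λ a _ → trans ([]R-·ʳ 𝔱R _ _ w) (*-congˡ (jacobi 𝔱R _ _ w))))) ⟩
        bracketTerm 0 (suc k) w
          + sumUpTo k (λ a → fromℕ (binom (suc k) (suc a))
                              * (bracketTerm (suc a) (k ∸ a) w + bracketTerm a (suc (k ∸ a)) w))
          ≈⟨ sumUpTo-pascal k (λ a b → bracketTerm a b w) ⟩
        defect (suc (suc k)) w ∎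

      D-ad𝔱^ : ∀ i → D (ad𝔱^ i B) ≈R ad𝔱^ i (D B) +R defect i
      D-ad𝔱^ zero w = sym (+-identityʳ _)
      D-ad𝔱^ (suc i) w = begin
        D (ad𝔱 (ad𝔱^ i B)) w
          ≈⟨ D-[]R 𝔱R (ad𝔱^ i B) w ⟩
        bracketTerm 0 i w + ad𝔱 (D (ad𝔱^ i B)) w
          ≈⟨ +-congˡ (trans ([]R-cong (λ _ → refl) (D-ad𝔱^ i) w) ([]R-+ʳ 𝔱R _ _ w)) ⟩
        bracketTerm 0 i w + (ad𝔱^ (suc i) (D B) w + ad𝔱 (defect i) w)
          ≈⟨ x+[y+z]≈y+[x+z] _ _ _ ⟩
        ad𝔱^ (suc i) (D B) w + (bracketTerm 0 i w + ad𝔱 (defect i) w)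
          ≈⟨ +-congˡ (defect-suc i w) ⟩
        ad𝔱^ (suc i) (D B) w + defect (suc i) w ∎

      *-defect-suc : ∀ (f : PS1) s w →
        f (suc s) * defect (suc s) w ≈ sumUpTo s (λ a → diffQuot f a (s ∸ a) * bracketTerm a (s ∸ a) w)
      *-defect-suc f s w = trans (*-distribˡ-sumUpTo s _ _) (sumUpTo-cong s term)
        where
          binomial : ℕ → ℕ → Carrier
          binomial a m = fromℕ (binom (suc m) (suc a))
          term : ∀ a → a ≤ s →
            f (suc s) * (binomial a s * bracketTerm a (s ∸ a) w) ≈ diffQuot f a (s ∸ a) * bracketTerm a (s ∸ a) w
          term a a≤s = begin
            f (suc s) * (binomial a s * bracketTerm a (s ∸ a) w)
              ≈⟨ trans (x*[y*z]≈y*[x*z] _ _ _) (sym (*-assoc _ _ _)) ⟩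
            (binomial a s * f (suc s)) * bracketTerm a (s ∸ a) w
              ≈⟨ *-congʳ (reflexive (≡.cong (λ m → binomial a m * f (suc m)) (≡.sym (ℕₚ.m+[n∸m]≡n a≤s)))) ⟩
            (binomial a (a ℕ.+ (s ∸ a)) * f (suc (a ℕ.+ (s ∸ a)))) * bracketTerm a (s ∸ a) w
              ≈⟨ *-congʳ (sym (x-0≈x _)) ⟩
            diffQuot f a (s ∸ a) * bracketTerm a (s ∸ a) w ∎

      sumUpTo-*-defect : ∀ (f : PS1) w →
        sumUpTo (suc (suc (length w))) (λ i → f i * defect i w) ≈ bracket𝔱 (diffQuot f) (D 𝔱R) B w
      sumUpTo-*-defect f w = begin
        sumUpTo (suc (suc n)) (λ i → f i * defect i w)
          ≈⟨ sumUpTo-suc-head (suc n) _ ⟩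
        f 0 * 0# + sumUpTo (suc n) (λ s → f (suc s) * defect (suc s) w)
          ≈⟨ +-cong (zeroʳ _) (sumUpTo-cong (suc n) (λ s _ → *-defect-suc f s w)) ⟩
        0# + sumUpTo (suc n) (λ s → sumUpTo s (λ a → h a (s ∸ a)))
          ≈⟨ trans (+-identityˡ _) (sumUpTo-truncate (suc n) _ (ℕₚ.n≤1+n n) diagonal≈0) ⟩
        sumUpTo n (λ s → sumUpTo s (λ a → h a (s ∸ a)))
          ≈⟨ sumUpTo-diagonals n h ⟩
        bracket𝔱 (diffQuot f) (D 𝔱R) B w ∎
        where
          n = length w
          h : ℕ → ℕ → Carrier
          h a b = diffQuot f a b * bracketTerm a b w
          diagonal≈0 : ∀ s → n < s → sumUpTo s (λ a → h a (s ∸ a)) ≈ 0#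
          diagonal≈0 s n<s = sumUpTo-zero s _ (λ a a≤s → *-zero-congʳ _
            (vanishesBelow-[]R (ad𝔱^-vanishesBelow a (D 𝔱R)) (ad𝔱^-vanishesBelow (s ∸ a) B) w
              (≡.subst (n <_) (≡.sym (ℕₚ.m+[n∸m]≡n a≤s)) n<s)))

lemma3p1p4 : ∀ {c ℓ} (K : CommutativeRing c ℓ) → let open NCPS K in
    (D : Ser → Ser) → IsDerivation D → (f : PS1) → (B : Ser) →
    D (evalAd f B) ≈R bracket𝔱 (diffQuot f) (D 𝔱R) B +R evalAd f (D B)
lemma3p1p4 K D isD f B w = begin
  D (evalAd f B) w
    ≈⟨ D-local (evalAd f B) (partialSum B) w (λ v lv → evalAd≈sumR f B M v (ℕₚ.m≤n⇒m≤1+n lv)) ⟩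
  D (partialSum B) w
    ≈⟨ D-sumR M _ w ⟩
  sumUpTo M (λ i → D (f i ·R ad𝔱^ i B) w)
    ≈⟨ sumUpTo-cong M (λ i _ → trans (homog (f i) _ w) (trans (*-congˡ (D-ad𝔱^ B i w)) (distribˡ _ _ _))) ⟩
  sumUpTo M (λ i → f i * ad𝔱^ i (D B) w + f i * defect B i w)
    ≈⟨ sumUpTo-+ M _ _ ⟩
  partialSum (D B) w + sumUpTo M (λ i → f i * defect B i w)
    ≈⟨ +-cong (sym (evalAd≈sumR f (D B) M w (ℕₚ.m≤n+m (length w) 2))) (sumUpTo-*-defect B f w) ⟩
  evalAd f (D B) w + bracket𝔱 (diffQuot f) (D 𝔱R) B w
    ≈⟨ +-comm _ _ ⟩
  bracket𝔱 (diffQuot f) (D 𝔱R) B w + evalAd f (D B) w ∎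
  where
    open CommutativeRing K
    open NCPS K
    open Series K
    open Derivation D isD
    open IsDerivation isD using (homog)
    open import Relation.Binary.Reasoning.Setoid setoid
    M = suc (suc (length w))
    partialSum : Ser → Ser
    partialSum C = sumR M (λ i → f i ·R ad𝔱^ i C)
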